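{- Let $G$ be a finite simple graph and let $H$ and $K$ be subgraphs of $G$. Then $\eta_G(H)\,\eta_G(K)\geq \eta_G(H\,\dot\cup\, K)$.
   Context: For graphs $H$ and $G$, $\eta_G(H)$ denotes the number of subgraphs of $G$ isomorphic to $H$. $H\,\dot\cup\,K$ denotes the disjoint union of the graphs $H$ and $K$. -}

module Defs where

open import Data.Nat using (ℕ; _+_)
open import Data.Bool using (Bool; true; false; _∧_; _∨_; not; if_then_else_)
open import Data.Fin using (Fin; splitAt)
import Data.Fin as Fin
open import Data.Vec using (Vec; []; _∷_; lookup)
open import Data.List using (List; []; _∷_; _++_; map; concatMap; length; filterᵇ; allFin)
open import Data.Bool.ListAction using (all; any)
open import Data.Sum using (_⊎_; inj₁; inj₂)
open import Data.Product using (Σ; _×_; _,_)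
open import Relation.Binary.PropositionalEquality using (_≡_; refl)
open import Relation.Nullary.Decidable using (⌊_⌋)

record Graph (n : ℕ) : Set where
  field
    adj    : Fin n → Fin n → Bool
    sym    : ∀ i j → adj i j ≡ adj j i
    irrefl : ∀ i → adj i i ≡ false
open Graph public

_⇒ᵇ_ : Bool → Bool → Bool
a ⇒ᵇ b = not a ∨ b

_==ᵇ_ : Bool → Bool → Bool
true  ==ᵇ b = b
false ==ᵇ b = not b

_==ᶠ_ : ∀ {n} → Fin n → Fin n → Bool
i ==ᶠ j = ⌊ i Fin.≟ j ⌋

allVecs : ∀ {A : Set} → List A → (n : ℕ) → List (Vec A n)
allVecs xs ℕ.zero    = [] ∷ []
allVecs xs (ℕ.suc n) = concatMap (λ x → map (x ∷_) (allVecs xs n)) xs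

bools : List Bool
bools = true ∷ false ∷ []

-- A (candidate) subgraph of a graph on Fin n is encoded by its vertex set
-- (characteristic vector) and its edge set (characteristic adjacency matrix).
SubgraphData : ℕ → Set
SubgraphData n = Vec Bool n × Vec (Vec Bool n) n

vtx : ∀ {n} → SubgraphData n → Fin n → Bool
vtx (S , E) v = lookup S v

edge : ∀ {n} → SubgraphData n → Fin n → Fin n → Bool
edge (S , E) u v = lookup (lookup E u) v

allSubgraphData : (n : ℕ) → List (SubgraphData n)
allSubgraphData n =
  concatMap (λ S → map (S ,_) (allVecs (allVecs bools n) n)) (allVecs bools n)

isSubgraph : ∀ {n} → Graph n → SubgraphData n → Bool
isSubgraph {n} G s =
  all (λ u → all (λ v →
        (edge s u v ==ᵇ edge s v u)
      ∧ (edge s u v ⇒ᵇ (adj G u v ∧ vtx s u ∧ vtx s v)))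
      (allFin n)) (allFin n)

-- The subgraph (S , E) of a graph on Fin n is isomorphic to H (on Fin m):
-- there is an injective map f : Fin m → Fin n with image exactly S such that
-- i ~_H j iff f i ~_E f j.  (f is then a bijection Fin m ≅ S preserving
-- and reflecting adjacency.)
isIsoTo : ∀ {n m} → SubgraphData n → Graph m → Bool
isIsoTo {n} {m} s H = any ok (allVecs (allFin n) m)
  where
  ok : Vec (Fin n) m → Bool
  ok f =
      all (λ i → all (λ j → (lookup f i ==ᶠ lookup f j) ⇒ᵇ (i ==ᶠ j)) (allFin m)) (allFin m)
    ∧ all (λ v → vtx s v ==ᵇ any (λ i → lookup f i ==ᶠ v) (allFin m)) (allFin n)
    ∧ all (λ i → all (λ j → adj H i j ==ᵇ edge s (lookup f i) (lookup f j)) (allFin m)) (allFin m)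

η : ∀ {n m} → Graph n → Graph m → ℕ
η {n} G H = length (filterᵇ (λ s → isSubgraph G s ∧ isIsoTo s H) (allSubgraphData n))

_⊑_ : ∀ {m n} → Graph m → Graph n → Set
_⊑_ {m} {n} H G = Σ (SubgraphData n) λ s → (isSubgraph G s ∧ isIsoTo s H) ≡ true

private
  adj⊎ : ∀ {m k} → Graph m → Graph k → Fin m ⊎ Fin k → Fin m ⊎ Fin k → Bool
  adj⊎ H K (inj₁ i) (inj₁ j) = adj H i j
  adj⊎ H K (inj₂ i) (inj₂ j) = adj K i j
  adj⊎ H K (inj₁ i) (inj₂ j) = false
  adj⊎ H K (inj₂ i) (inj₁ j) = false

  adj⊎-sym : ∀ {m k} (H : Graph m) (K : Graph k) x y → adj⊎ H K x y ≡ adj⊎ H K y x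
  adj⊎-sym H K (inj₁ i) (inj₁ j) = sym H i j
  adj⊎-sym H K (inj₂ i) (inj₂ j) = sym K i j
  adj⊎-sym H K (inj₁ i) (inj₂ j) = refl
  adj⊎-sym H K (inj₂ i) (inj₁ j) = refl

  adj⊎-irr : ∀ {m k} (H : Graph m) (K : Graph k) x → adj⊎ H K x x ≡ false
  adj⊎-irr H K (inj₁ i) = irrefl H i
  adj⊎-irr H K (inj₂ i) = irrefl K i

_∪̇_ : ∀ {m k} → Graph m → Graph k → Graph (m + k)
_∪̇_ {m} H K = record
  { adj    = λ i j → adj⊎ H K (splitAt m i) (splitAt m j)
  ; sym    = λ i j → adj⊎-sym H K (splitAt m i) (splitAt m j)
  ; irrefl = λ i → adj⊎-irr H K (splitAt m i)
  }

-- Let s be a copy of H ∪̇ K in G, embedded by f. The parts of s induced on the images of the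
-- H-half and of the K-half of f are copies of H and of K, and since H ∪̇ K has no edges between
-- its halves, s is their union. So every copy of H ∪̇ K is the union of a copy of H and a copy
-- of K, and there are at most η G H * η G K of them.
module Submission where

open import Defs hiding (sym)
open import Data.Nat using (ℕ; _*_; _≥_; _+_; _≤_; z≤n; s≤s; zero; suc)
open import Data.Nat.Properties using (module ≤-Reasoning)
open import Data.Bool using (Bool; true; false; _∧_; _∨_; T)
open import Data.Bool.Properties using (T-∧; T-∨; T-≡; ∧-comm; ∧-identityʳ)
open import Data.Empty using (⊥-elim)
open import Data.Fin using (Fin; splitAt; _↑ˡ_; _↑ʳ_)
open import Data.Fin.Properties
  using (splitAt-↑ˡ; splitAt-↑ʳ; splitAt⁻¹-↑ˡ; splitAt⁻¹-↑ʳ; ↑ˡ-injective; ↑ʳ-injective)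
open import Data.List
  using (List; []; _∷_; _++_; map; concatMap; length; filterᵇ; allFin; cartesianProductWith)
open import Data.List.Properties using (length-++; length-map; length-removeAt′; map-cong)
open import Data.Bool.ListAction using (all; any; or)
import Data.List.Relation.Unary.All as All
open import Data.List.Relation.Unary.All.Properties using (all⁺; all⁻)
open import Data.List.Relation.Unary.Any using (here; there; _─_; satisfied)
open import Data.List.Relation.Unary.Any.Properties using (any⁺; any⁻)
open import Data.List.Membership.Propositional using (_∈_; lose)
open import Data.List.Membership.Propositional.Properties
  using (∈-allFin; ∈-cartesianProductWith⁺; ∈-filter⁺; ∈-filter⁻)
open import Data.List.Relation.Binary.Subset.Propositional using (_⊆_)
open import Data.List.Relation.Unary.Unique.Propositional using (Unique)
import Data.List.Relation.Unary.Unique.Propositional.Properties as Unique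
import Data.List.Relation.Unary.AllPairs as AllPairs
open import Data.Sum using (_⊎_; inj₁; inj₂)
open import Data.Product using (∃; _×_; _,_; proj₁; proj₂)
open import Data.Vec using (Vec; []; _∷_; lookup; tabulate)
open import Data.Vec.Properties using (lookup∘tabulate; tabulate∘lookup; tabulate-cong)
open import Function using (_∘_; _⇔_; mk⇔; Equivalence)
open import Function.Definitions using (Injective)
open import Relation.Binary.PropositionalEquality
  using (_≡_; _≢_; refl; sym; trans; cong; cong₂; subst; module ≡-Reasoning)
open import Relation.Nullary.Decidable using (toWitness; fromWitness)
open import Relation.Nullary.Decidable.Core using (T?)

open Equivalence using (to; from)

private
  variable
    A B C : Set
    m n k : ℕ

∈-─ : ∀ {x y : A} {ys} (x∈ys : x ∈ ys) → y ∈ ys → y ≢ x → y ∈ (ys ─ x∈ys)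
∈-─ (here refl) (here refl)   y≢x = ⊥-elim (y≢x refl)
∈-─ (here refl) (there y∈ys)  y≢x = y∈ys
∈-─ (there x∈ys) (here refl)  y≢x = here refl
∈-─ (there x∈ys) (there y∈ys) y≢x = there (∈-─ x∈ys y∈ys y≢x)

Unique-⊆⇒length≤ : ∀ {xs ys : List A} → Unique xs → xs ⊆ ys → length xs ≤ length ys
Unique-⊆⇒length≤ AllPairs.[] _ = z≤n
Unique-⊆⇒length≤ {xs = _ ∷ xs} {ys} (x∉xs AllPairs.∷ xs!) x∷xs⊆ys = begin
  suc (length xs)          ≤⟨ s≤s (Unique-⊆⇒length≤ xs! xs⊆ys─x) ⟩
  suc (length (ys ─ x∈ys)) ≡⟨ length-removeAt′ ys _ ⟨
  length ys                ∎
  where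
  open ≤-Reasoning
  x∈ys = x∷xs⊆ys (here refl)
  xs⊆ys─x : xs ⊆ (ys ─ x∈ys)
  xs⊆ys─x y∈xs = ∈-─ x∈ys (x∷xs⊆ys (there y∈xs)) (λ { refl → All.lookup x∉xs y∈xs refl })

length-cartesianProductWith : ∀ (f : A → B → C) xs ys →
  length (cartesianProductWith f xs ys) ≡ length xs * length ys
length-cartesianProductWith f []       ys = refl
length-cartesianProductWith f (x ∷ xs) ys = begin
  length (map (f x) ys ++ cartesianProductWith f xs ys)          ≡⟨ length-++ (map (f x) ys) ⟩
  length (map (f x) ys) + length (cartesianProductWith f xs ys)  ≡⟨ cong₂ _+_ (length-map (f x) ys)
                                                                      (length-cartesianProductWith f xs ys) ⟩
  length ys + length xs * length ys                              ∎
  where open ≡-Reasoning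

concatMap-map≡cartesianProductWith : ∀ (f : A → B → C) xs ys →
  concatMap (λ x → map (f x) ys) xs ≡ cartesianProductWith f xs ys
concatMap-map≡cartesianProductWith f []       ys = refl
concatMap-map≡cartesianProductWith f (x ∷ xs) ys =
  cong (map (f x) ys ++_) (concatMap-map≡cartesianProductWith f xs ys)

allVecs-suc : ∀ (xs : List A) n →
  allVecs xs (suc n) ≡ cartesianProductWith _∷_ xs (allVecs xs n)
allVecs-suc xs n = concatMap-map≡cartesianProductWith _∷_ xs (allVecs xs n)

allVecs-unique : ∀ {xs : List A} n → Unique xs → Unique (allVecs xs n)
allVecs-unique zero    xs! = All.[] AllPairs.∷ AllPairs.[]
allVecs-unique {xs = xs} (suc n) xs! = subst Unique (sym (allVecs-suc xs n))
  (Unique.cartesianProductWith⁺ _∷_ (λ { refl → refl , refl }) xs! (allVecs-unique n xs!))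

∈-allVecs : ∀ {xs : List A} → (∀ x → x ∈ xs) → ∀ {n} (v : Vec A n) → v ∈ allVecs xs n
∈-allVecs ∈xs []      = here refl
∈-allVecs {xs = xs} ∈xs {suc n} (x ∷ v) = subst (_ ∈_) (sym (allVecs-suc xs n))
  (∈-cartesianProductWith⁺ _∷_ (∈xs x) (∈-allVecs ∈xs v))

∈-bools : ∀ b → b ∈ bools
∈-bools true  = here refl
∈-bools false = there (here refl)

bools-unique : Unique bools
bools-unique = ((λ ()) All.∷ All.[]) AllPairs.∷ (All.[] AllPairs.∷ AllPairs.[])

allSubgraphData-cartesianProduct : ∀ n → allSubgraphData n ≡
  cartesianProductWith _,_ (allVecs bools n) (allVecs (allVecs bools n) n)
allSubgraphData-cartesianProduct n =
  concatMap-map≡cartesianProductWith _,_ (allVecs bools n) (allVecs (allVecs bools n) n)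

allSubgraphData-unique : ∀ n → Unique (allSubgraphData n)
allSubgraphData-unique n = subst Unique (sym (allSubgraphData-cartesianProduct n))
  (Unique.cartesianProductWith⁺ _,_ (λ { refl → refl , refl })
    (allVecs-unique n bools-unique) (allVecs-unique n (allVecs-unique n bools-unique)))

∈-allSubgraphData : ∀ (s : SubgraphData n) → s ∈ allSubgraphData n
∈-allSubgraphData {n} (S , E) = subst (_ ∈_) (sym (allSubgraphData-cartesianProduct n))
  (∈-cartesianProductWith⁺ _,_ (∈-allVecs ∈-bools S) (∈-allVecs (∈-allVecs ∈-bools) E))

T-==ᵇ : ∀ {a b} → T (a ==ᵇ b) ⇔ (a ≡ b)
T-==ᵇ {true}  {true}  = mk⇔ (λ _ → refl) (λ _ → _)
T-==ᵇ {true}  {false} = mk⇔ (λ ()) (λ ())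
T-==ᵇ {false} {true}  = mk⇔ (λ ()) (λ ())
T-==ᵇ {false} {false} = mk⇔ (λ _ → refl) (λ _ → _)

T-⇒ᵇ : ∀ {a b} → T (a ⇒ᵇ b) ⇔ (T a → T b)
T-⇒ᵇ {true}  = mk⇔ (λ b _ → b) (λ f → f _)
T-⇒ᵇ {false} = mk⇔ (λ _ ()) (λ _ → _)

T-==ᶠ : ∀ {i j : Fin n} → T (i ==ᶠ j) ⇔ (i ≡ j)
T-==ᶠ = mk⇔ toWitness fromWitness

T⇔T⇒≡ : ∀ {a b} → T a ⇔ T b → a ≡ b
T⇔T⇒≡ {true}  {true}  _   = refl
T⇔T⇒≡ {true}  {false} a⇔b = ⊥-elim (to a⇔b _)
T⇔T⇒≡ {false} {true}  a⇔b = ⊥-elim (from a⇔b _)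
T⇔T⇒≡ {false} {false} _   = refl

T-all-allFin : ∀ {p : Fin n → Bool} → T (all p (allFin n)) ⇔ (∀ i → T (p i))
T-all-allFin {n} {p} = mk⇔
  (λ h i → All.lookup (all⁺ p (allFin n) h) (∈-allFin i))
  (λ h → all⁻ p {allFin n} (All.tabulate (λ {i} _ → h i)))

T-all²-allFin : ∀ {p : Fin m → Fin m → Bool} →
  T (all (λ i → all (p i) (allFin m)) (allFin m)) ⇔ (∀ i j → T (p i j))
T-all²-allFin = mk⇔ (λ h i → to T-all-allFin (to T-all-allFin h i))
                    (λ h → from T-all-allFin (λ i → from T-all-allFin (h i)))

T-any-allFin : ∀ {p : Fin n → Bool} → T (any p (allFin n)) ⇔ ∃ (T ∘ p)
T-any-allFin {n} {p} = mk⇔ (satisfied ∘ any⁻ p (allFin n))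
                            (λ (i , pi) → any⁺ p (lose (∈-allFin i) pi))

record IsSubgraphOf (G : Graph n) (s : SubgraphData n) : Set where
  field
    edge-sym  : ∀ u v → edge s u v ≡ edge s v u
    edge-incl : ∀ u v → T (edge s u v) → T (adj G u v ∧ vtx s u ∧ vtx s v)

isSubgraph⇔ : ∀ {G : Graph n} {s} → T (isSubgraph G s) ⇔ IsSubgraphOf G s
isSubgraph⇔ = mk⇔
  (λ h → let conds = λ u v → to T-∧ (to T-all²-allFin h u v) in record
    { edge-sym  = λ u v → to T-==ᵇ (proj₁ (conds u v))
    ; edge-incl = λ u v → to T-⇒ᵇ (proj₂ (conds u v))
    })
  (λ s⊆G → let open IsSubgraphOf s⊆G in from T-all²-allFin λ u v →
    from T-∧ (from T-==ᵇ (edge-sym u v) , from T-⇒ᵇ (edge-incl u v)))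

image : (Fin m → Fin n) → Fin n → Bool
image {m} f v = any (λ i → f i ==ᶠ v) (allFin m)

T-image : ∀ (f : Fin m → Fin n) {v} → T (image f v) ⇔ ∃ λ i → f i ≡ v
T-image f = mk⇔ (λ h → let (i , fi==v) = to T-any-allFin h in i , to T-==ᶠ fi==v)
              (λ (i , fi≡v) → from T-any-allFin (i , from T-==ᶠ fi≡v))

injective? : (Fin m → Fin n) → Bool
injective? {m} f = all (λ i → all (λ j → (f i ==ᶠ f j) ⇒ᵇ (i ==ᶠ j)) (allFin m)) (allFin m)

vtx≡image? : SubgraphData n → (Fin m → Fin n) → Bool
vtx≡image? {n} s f = all (λ v → vtx s v ==ᵇ image f v) (allFin n)

adj≡edge? : SubgraphData n → Graph m → (Fin m → Fin n) → Bool
adj≡edge? {m = m} s X f =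
  all (λ i → all (λ j → adj X i j ==ᵇ edge s (f i) (f j)) (allFin m)) (allFin m)

-- isIsoTo s X unfolds to any (embeds? s X ∘ lookup) (allVecs (allFin n) m).
embeds? : SubgraphData n → Graph m → (Fin m → Fin n) → Bool
embeds? s X f = injective? f ∧ vtx≡image? s f ∧ adj≡edge? s X f

record Embeds (s : SubgraphData n) (X : Graph m) (f : Fin m → Fin n) : Set where
  field
    injective : Injective _≡_ _≡_ f
    vtx≡image : ∀ v → vtx s v ≡ image f v
    adj≡edge  : ∀ i j → adj X i j ≡ edge s (f i) (f j)

embeds?⇔ : ∀ {s : SubgraphData n} {X : Graph m} {f} → T (embeds? s X f) ⇔ Embeds s X f
embeds?⇔ {s = s} {X} {f} = mk⇔ to′ from′
  where
  to′ : T (embeds? s X f) → Embeds s X f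
  to′ h = record
    { injective = λ {i} {j} fi≡fj → to T-==ᶠ (to T-⇒ᵇ (to T-all²-allFin inj i j) (from T-==ᶠ fi≡fj))
    ; vtx≡image = λ v → to T-==ᵇ (to T-all-allFin vtx≡ v)
    ; adj≡edge  = λ i j → to T-==ᵇ (to T-all²-allFin adj≡ i j)
    }
    where
    inj  = proj₁ (to (T-∧ {injective? f}) h)
    rest = to (T-∧ {vtx≡image? s f}) (proj₂ (to (T-∧ {injective? f}) h))
    vtx≡ = proj₁ rest
    adj≡ = proj₂ rest
  from′ : Embeds s X f → T (embeds? s X f)
  from′ e = from (T-∧ {injective? f})
    ( from T-all²-allFin (λ i j → from (T-⇒ᵇ {f i ==ᶠ f j}) (from T-==ᶠ ∘ injective ∘ to T-==ᶠ))
    , from (T-∧ {vtx≡image? s f})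
        ( from T-all-allFin (from T-==ᵇ ∘ vtx≡image)
        , from T-all²-allFin (λ i j → from T-==ᵇ (adj≡edge i j))))
    where open Embeds e

Embeds-cong : ∀ {s : SubgraphData n} {X : Graph m} {f g} →
  (∀ i → f i ≡ g i) → Embeds s X f → Embeds s X g
Embeds-cong {m = m} {s = s} {f = f} {g} f≗g e = record
  { injective = λ gi≡gj → injective (trans (f≗g _) (trans gi≡gj (sym (f≗g _))))
  ; vtx≡image = λ v → trans (vtx≡image v) (cong or (map-cong (λ i → cong (_==ᶠ v) (f≗g i)) (allFin m)))
  ; adj≡edge  = λ i j → trans (adj≡edge i j) (cong₂ (edge s) (f≗g i) (f≗g j))
  }
  where open Embeds e

isIsoTo⇔ : ∀ {s : SubgraphData n} {X : Graph m} → T (isIsoTo s X) ⇔ ∃ (Embeds s X)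
isIsoTo⇔ {n} {m} {s} {X} = mk⇔
  (λ h → let (f , ok) = satisfied (any⁻ (embeds? s X ∘ lookup) (allVecs (allFin n) m) h)
         in lookup f , to embeds?⇔ ok)
  (λ (f , e) → any⁺ (embeds? s X ∘ lookup) (lose (∈-allVecs ∈-allFin (tabulate f))
    (from embeds?⇔ (Embeds-cong (λ i → sym (lookup∘tabulate f i)) e))))

IsCopy : Graph n → Graph m → SubgraphData n → Set
IsCopy G X s = IsSubgraphOf G s × ∃ (Embeds s X)

isCopy? : Graph n → Graph m → SubgraphData n → Bool
isCopy? G X s = isSubgraph G s ∧ isIsoTo s X

copies : Graph n → Graph m → List (SubgraphData n)
copies {n} G X = filterᵇ (isCopy? G X) (allSubgraphData n)

∈-copies⇔ : ∀ {G : Graph n} {X : Graph m} {s} → s ∈ copies G X ⇔ IsCopy G X s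
∈-copies⇔ {n} {G = G} {X} {s} = mk⇔
  (λ s∈ → let s∈copy = proj₂ (∈-filter⁻ P? {xs = allSubgraphData n} s∈)
              (s⊆G , s≅X) = to (T-∧ {isSubgraph G s}) s∈copy
          in to isSubgraph⇔ s⊆G , to isIsoTo⇔ s≅X)
  (λ (s⊆G , s≅X) → ∈-filter⁺ P? (∈-allSubgraphData s)
     (from (T-∧ {isSubgraph G s}) (from isSubgraph⇔ s⊆G , from isIsoTo⇔ s≅X)))
  where P? = T? ∘ isCopy? G X

copies-unique : ∀ (G : Graph n) (X : Graph m) → Unique (copies G X)
copies-unique {n} G X = Unique.filter⁺ (T? ∘ isCopy? G X) (allSubgraphData-unique n)

restrict : SubgraphData n → (Fin n → Bool) → SubgraphData n
restrict s S = tabulate S , tabulate (λ u → tabulate (λ v → edge s u v ∧ S u ∧ S v))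

_∪ˢ_ : SubgraphData n → SubgraphData n → SubgraphData n
s ∪ˢ t = tabulate (λ v → vtx s v ∨ vtx t v)
       , tabulate (λ u → tabulate (λ v → edge s u v ∨ edge t u v))

edge-tabulate : ∀ (S : Vec Bool n) (E : Fin n → Fin n → Bool) u v →
  edge (S , tabulate (tabulate ∘ E)) u v ≡ E u v
edge-tabulate S E u v = trans (cong (λ row → lookup row v) (lookup∘tabulate (tabulate ∘ E) u))
                              (lookup∘tabulate (E u) v)

SubgraphData-ext : ∀ {s t : SubgraphData n} →
  (∀ v → vtx s v ≡ vtx t v) → (∀ u v → edge s u v ≡ edge t u v) → s ≡ t
SubgraphData-ext {s = S , E} {S′ , E′} vtx≗ edge≗ = cong₂ _,_
  (trans (sym (tabulate∘lookup S)) (trans (tabulate-cong vtx≗) (tabulate∘lookup S′)))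
  (trans (sym (tabulate∘lookup E)) (trans (tabulate-cong row≗) (tabulate∘lookup E′)))
  where
  row≗ : ∀ u → lookup E u ≡ lookup E′ u
  row≗ u = trans (sym (tabulate∘lookup _)) (trans (tabulate-cong (edge≗ u)) (tabulate∘lookup _))

vtx-restrict : ∀ (s : SubgraphData n) S v → vtx (restrict s S) v ≡ S v
vtx-restrict s S v = lookup∘tabulate S v

edge-restrict : ∀ (s : SubgraphData n) S u v → edge (restrict s S) u v ≡ edge s u v ∧ S u ∧ S v
edge-restrict s S u v = edge-tabulate (tabulate S) (λ u v → edge s u v ∧ S u ∧ S v) u v

restrict-isSubgraph : ∀ {G : Graph n} {s} S → IsSubgraphOf G s → IsSubgraphOf G (restrict s S)
restrict-isSubgraph {G = G} {s} S s⊆G = record { edge-sym = edge-sym′ ; edge-incl = edge-incl′ }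
  where
  open IsSubgraphOf s⊆G
  edge-sym′ : ∀ u v → edge (restrict s S) u v ≡ edge (restrict s S) v u
  edge-sym′ u v rewrite edge-restrict s S u v | edge-restrict s S v u =
    cong₂ _∧_ (edge-sym u v) (∧-comm (S u) (S v))
  edge-incl′ : ∀ u v → T (edge (restrict s S) u v) →
    T (adj G u v ∧ vtx (restrict s S) u ∧ vtx (restrict s S) v)
  edge-incl′ u v uv∈ rewrite edge-restrict s S u v | vtx-restrict s S u | vtx-restrict s S v =
    let (uv∈s , Su∧Sv) = to (T-∧ {edge s u v}) uv∈
    in  from (T-∧ {adj G u v}) (proj₁ (to (T-∧ {adj G u v}) (edge-incl u v uv∈s)) , Su∧Sv)

∈-image : ∀ (f : Fin m → Fin n) i → T (image f (f i))
∈-image f i = from (T-image f) (i , refl)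

restrict-image-embeds : ∀ {s : SubgraphData n} {Y : Graph m} {g} → Injective _≡_ _≡_ g →
  (∀ i j → adj Y i j ≡ edge s (g i) (g j)) → Embeds (restrict s (image g)) Y g
restrict-image-embeds {s = s} {Y} {g} g-inj adj≡ = record
  { injective = g-inj
  ; vtx≡image = vtx-restrict s (image g)
  ; adj≡edge  = adj≡edge′
  }
  where
  adj≡edge′ : ∀ i j → adj Y i j ≡ edge (restrict s (image g)) (g i) (g j)
  adj≡edge′ i j rewrite edge-restrict s (image g) (g i) (g j)
                      | to T-≡ (∈-image g i) | to T-≡ (∈-image g j) =
    trans (adj≡ i j) (sym (∧-identityʳ _))

vtx-∪ˢ : ∀ (s t : SubgraphData n) v → vtx (s ∪ˢ t) v ≡ vtx s v ∨ vtx t v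
vtx-∪ˢ s t v = lookup∘tabulate (λ v → vtx s v ∨ vtx t v) v

edge-∪ˢ : ∀ (s t : SubgraphData n) u v → edge (s ∪ˢ t) u v ≡ edge s u v ∨ edge t u v
edge-∪ˢ s t u v = edge-tabulate (proj₁ (s ∪ˢ t)) (λ u v → edge s u v ∨ edge t u v) u v

∧-∨-∧-cover : ∀ e x y → (T e → T x ⊎ T y) → e ≡ (e ∧ x) ∨ (e ∧ y)
∧-∨-∧-cover false x     y     _ = refl
∧-∨-∧-cover true  true  y     _ = refl
∧-∨-∧-cover true  false true  _ = refl
∧-∨-∧-cover true  false false h with h _
... | inj₁ ()
... | inj₂ ()

restrict-∪ˢ-restrict : ∀ {s : SubgraphData n} S S′ → (∀ v → vtx s v ≡ S v ∨ S′ v) →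
  (∀ u v → T (edge s u v) → T (S u ∧ S v) ⊎ T (S′ u ∧ S′ v)) →
  s ≡ restrict s S ∪ˢ restrict s S′
restrict-∪ˢ-restrict {s = s} S S′ vtx≡ edge-covered = SubgraphData-ext vtx≗ edge≗
  where
  open ≡-Reasoning
  r  = restrict s S
  r′ = restrict s S′
  vtx≗ : ∀ v → vtx s v ≡ vtx (r ∪ˢ r′) v
  vtx≗ v = begin
    vtx s v            ≡⟨ vtx≡ v ⟩
    S v ∨ S′ v         ≡⟨ cong₂ _∨_ (vtx-restrict s S v) (vtx-restrict s S′ v) ⟨
    vtx r v ∨ vtx r′ v ≡⟨ vtx-∪ˢ r r′ v ⟨
    vtx (r ∪ˢ r′) v    ∎
  edge≗ : ∀ u v → edge s u v ≡ edge (r ∪ˢ r′) u v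
  edge≗ u v = begin
    edge s u v                                            ≡⟨ ∧-∨-∧-cover _ _ _ (edge-covered u v) ⟩
    (edge s u v ∧ S u ∧ S v) ∨ (edge s u v ∧ S′ u ∧ S′ v) ≡⟨ cong₂ _∨_ (edge-restrict s S u v)
                                                                       (edge-restrict s S′ u v) ⟨
    edge r u v ∨ edge r′ u v                              ≡⟨ edge-∪ˢ r r′ u v ⟨
    edge (r ∪ˢ r′) u v                                    ∎

edge⇒vtx : ∀ {G : Graph n} {s} → IsSubgraphOf G s →
  ∀ u v → T (edge s u v) → T (vtx s u) × T (vtx s v)
edge⇒vtx {G = G} {s} s⊆G u v uv∈s =
  to (T-∧ {vtx s u}) (proj₂ (to (T-∧ {adj G u v}) (IsSubgraphOf.edge-incl s⊆G u v uv∈s)))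

data ↑-View (m k : ℕ) : Fin (m + k) → Set where
  ↑ˡ-view : ∀ i → ↑-View m k (i ↑ˡ k)
  ↑ʳ-view : ∀ j → ↑-View m k (m ↑ʳ j)

↑-view : ∀ m {k} (x : Fin (m + k)) → ↑-View m k x
↑-view m x with splitAt m x in eq
... | inj₁ i = subst (↑-View m _) (splitAt⁻¹-↑ˡ eq) (↑ˡ-view i)
... | inj₂ j = subst (↑-View m _) (splitAt⁻¹-↑ʳ eq) (↑ʳ-view j)

image-↑ : ∀ m {k} (f : Fin (m + k) → Fin n) v →
  image f v ≡ image (f ∘ (_↑ˡ k)) v ∨ image (f ∘ (m ↑ʳ_)) v
image-↑ m {k} f v = T⇔T⇒≡ (mk⇔ split join)
  where
  fˡ = f ∘ (_↑ˡ k)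
  fʳ = f ∘ (m ↑ʳ_)
  split : T (image f v) → T (image fˡ v ∨ image fʳ v)
  split fx∈ with to (T-image f) fx∈
  ... | x , fx≡v with ↑-view m x
  ...   | ↑ˡ-view i = from (T-∨ {image fˡ v}) (inj₁ (from (T-image fˡ) (i , fx≡v)))
  ...   | ↑ʳ-view j = from (T-∨ {image fˡ v}) (inj₂ (from (T-image fʳ) (j , fx≡v)))
  join : T (image fˡ v ∨ image fʳ v) → T (image f v)
  join h with to (T-∨ {image fˡ v}) h
  ... | inj₁ fi∈ = let (i , fi≡v) = to (T-image fˡ) fi∈ in from (T-image f) (i ↑ˡ k , fi≡v)
  ... | inj₂ fj∈ = let (j , fj≡v) = to (T-image fʳ) fj∈ in from (T-image f) (m ↑ʳ j , fj≡v)

module _ (H : Graph m) (K : Graph k) where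

  adj-∪̇-↑ˡ : ∀ i j → adj (H ∪̇ K) (i ↑ˡ k) (j ↑ˡ k) ≡ adj H i j
  adj-∪̇-↑ˡ i j rewrite splitAt-↑ˡ m i k | splitAt-↑ˡ m j k = refl

  adj-∪̇-↑ʳ : ∀ i j → adj (H ∪̇ K) (m ↑ʳ i) (m ↑ʳ j) ≡ adj K i j
  adj-∪̇-↑ʳ i j rewrite splitAt-↑ʳ m k i | splitAt-↑ʳ m k j = refl

  adj-∪̇-↑ˡ↑ʳ : ∀ i j → adj (H ∪̇ K) (i ↑ˡ k) (m ↑ʳ j) ≡ false
  adj-∪̇-↑ˡ↑ʳ i j rewrite splitAt-↑ˡ m i k | splitAt-↑ʳ m k j = refl

  adj-∪̇-↑ʳ↑ˡ : ∀ i j → adj (H ∪̇ K) (m ↑ʳ i) (j ↑ˡ k) ≡ false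
  adj-∪̇-↑ʳ↑ˡ i j rewrite splitAt-↑ʳ m k i | splitAt-↑ˡ m j k = refl

module ∪̇-Copy {G : Graph n} {H : Graph m} {K : Graph k}
  {s : SubgraphData n} {f : Fin (m + k) → Fin n}
  (s⊆G : IsSubgraphOf G s) (s≅H∪̇K : Embeds s (H ∪̇ K) f) where

  open Embeds s≅H∪̇K

  fH : Fin m → Fin n
  fH = f ∘ (_↑ˡ k)

  fK : Fin k → Fin n
  fK = f ∘ (m ↑ʳ_)

  H-part K-part : SubgraphData n
  H-part = restrict s (image fH)
  K-part = restrict s (image fK)

  H-part-copy : IsCopy G H H-part
  H-part-copy = restrict-isSubgraph (image fH) s⊆G , fH ,
    restrict-image-embeds {s = s} (↑ˡ-injective k _ _ ∘ injective)
      (λ i j → trans (sym (adj-∪̇-↑ˡ H K i j)) (adj≡edge _ _))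

  K-part-copy : IsCopy G K K-part
  K-part-copy = restrict-isSubgraph (image fK) s⊆G , fK ,
    restrict-image-embeds {s = s} (↑ʳ-injective m _ _ ∘ injective)
      (λ i j → trans (sym (adj-∪̇-↑ʳ H K i j)) (adj≡edge _ _))

  -- H ∪̇ K has no edges between its two parts, so neither has its copy s.
  edge-within-part : ∀ x y → T (edge s (f x) (f y)) →
    T (image fH (f x) ∧ image fH (f y)) ⊎ T (image fK (f x) ∧ image fK (f y))
  edge-within-part x y e with ↑-view m x | ↑-view m y
  ... | ↑ˡ-view i | ↑ˡ-view j = inj₁ (from (T-∧ {image fH (fH i)}) (∈-image fH i , ∈-image fH j))
  ... | ↑ʳ-view i | ↑ʳ-view j = inj₂ (from (T-∧ {image fK (fK i)}) (∈-image fK i , ∈-image fK j))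
  ... | ↑ˡ-view i | ↑ʳ-view j = ⊥-elim (subst T (trans (sym (adj≡edge _ _)) (adj-∪̇-↑ˡ↑ʳ H K i j)) e)
  ... | ↑ʳ-view i | ↑ˡ-view j = ⊥-elim (subst T (trans (sym (adj≡edge _ _)) (adj-∪̇-↑ʳ↑ˡ H K i j)) e)

  edge-covered : ∀ u v → T (edge s u v) →
    T (image fH u ∧ image fH v) ⊎ T (image fK u ∧ image fK v)
  edge-covered u v uv∈s
    with (x , refl) ← to (T-image f) (subst T (vtx≡image u) (proj₁ (edge⇒vtx s⊆G u v uv∈s)))
       | (y , refl) ← to (T-image f) (subst T (vtx≡image v) (proj₂ (edge⇒vtx s⊆G u v uv∈s)))
    = edge-within-part x y uv∈s

  s≡H-part∪K-part : s ≡ H-part ∪ˢ K-part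
  s≡H-part∪K-part = restrict-∪ˢ-restrict (image fH) (image fK)
    (λ v → trans (vtx≡image v) (image-↑ m f v)) edge-covered

copies-∪̇⊆ : ∀ (G : Graph n) (H : Graph m) (K : Graph k) →
  copies G (H ∪̇ K) ⊆ cartesianProductWith _∪ˢ_ (copies G H) (copies G K)
copies-∪̇⊆ G H K s∈ with to (∈-copies⇔ {X = H ∪̇ K}) s∈
... | s⊆G , f , s≅H∪̇K = subst (_∈ cartesianProductWith _∪ˢ_ (copies G H) (copies G K))
  (sym s≡H-part∪K-part)
  (∈-cartesianProductWith⁺ _∪ˢ_ (from ∈-copies⇔ H-part-copy) (from ∈-copies⇔ K-part-copy))
  where open ∪̇-Copy {G = G} {H} {K} s⊆G s≅H∪̇K

lemma2p8 : {n m k : ℕ} (G : Graph n) (H : Graph m) (K : Graph k) →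
    H ⊑ G → K ⊑ G →
    η G H * η G K ≥ η G (H ∪̇ K)
lemma2p8 G H K _ _ = begin
  length (copies G (H ∪̇ K))                ≤⟨ Unique-⊆⇒length≤ (copies-unique G (H ∪̇ K)) (copies-∪̇⊆ G H K) ⟩
  length (cartesianProductWith _∪ˢ_ Hs Ks) ≡⟨ length-cartesianProductWith _∪ˢ_ Hs Ks ⟩
  length Hs * length Ks                    ∎
  where
  open ≤-Reasoning
  Hs = copies G H
  Ks = copies G K
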